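{- Let $\mu$ be a $0$-$1$ word on $\mathbb N$. The graph $G_\mu$ is prime if and only if $\mu\notin\{011111\ldots,\ 100000\ldots,\ 0011111\ldots,\ 1100000\ldots\}$.
   Context: For $\mu:\mathbb N\to\{0,1\}$, $G_\mu$ is the graph with vertex set $\{ -1\}\cup\mathbb N$ in which, for vertices $i<j$, $\{i,j\}$ is an edge iff either ($\mu_j=1$ and $j=i+1$) or ($\mu_j=0$ and $j\neq i+1$). The listed words are $0$ followed by all $1$'s, $1$ followed by all $0$'s, $00$ followed by all $1$'s, and $11$ followed by all $0$'s. A module of a graph is a vertex set $M$ such that each vertex outside $M$ is adjacent to all or to none of the vertices of $M$; the graph is prime if its only modules are $\emptyset$, singletons and the whole vertex set. -}

module Defs where

open import Data.Nat using (ℕ; zero; suc; _<_)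
open import Data.Bool using (Bool; true; false)
open import Data.Product using (_×_; ∃; ∃-syntax; _,_)
open import Data.Sum using (_⊎_)
open import Relation.Nullary using (¬_)
open import Data.Empty using (⊥)
open import Relation.Binary.PropositionalEquality using (_≡_; _≢_)

-- A 0-1 word on ℕ (false = 0, true = 1).
Word : Set
Word = ℕ → Bool

data V : Set where
  minus1 : V
  nat    : ℕ → V

-- Shifted position: pos v = v + 1 (so the order on V is the order on ℤ).
pos : V → ℕ
pos minus1  = 0
pos (nat n) = suc n

-- Edge rule for a pair i < j (given as the larger vertex j ∈ ℕ and the smaller i):
-- {i,j} edge iff (μ_j = 1 and j = i+1) or (μ_j = 0 and j ≠ i+1).
EdgeUp : Word → V → ℕ → Set
EdgeUp μ i j = (μ j ≡ true × suc (pos i) ≡ pos (nat j))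
             ⊎ (μ j ≡ false × suc (pos i) ≢ pos (nat j))

Adj : Word → V → V → Set
Adj μ minus1 minus1   = ⊥
Adj μ minus1 (nat j)  = EdgeUp μ minus1 j
Adj μ (nat i) minus1  = EdgeUp μ minus1 i
Adj μ (nat i) (nat j) = (i < j × EdgeUp μ (nat i) j) ⊎ (j < i × EdgeUp μ (nat j) i)

IsModule : Word → (V → Set) → Set
IsModule μ M = ∀ x → ¬ M x → (∀ m → M m → Adj μ x m) ⊎ (∀ m → M m → ¬ Adj μ x m)

IsTrivial : (V → Set) → Set
IsTrivial M = (∀ v → ¬ M v)
            ⊎ (∃[ v ] (∀ w → (M w → w ≡ v) × (w ≡ v → M w)))
            ⊎ (∀ v → M v)

IsPrime : Word → Set₁
IsPrime μ = ∀ (M : V → Set) → IsModule μ M → IsTrivial M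

w0111 : Word
w0111 zero    = false
w0111 (suc _) = true

w1000 : Word
w1000 zero    = true
w1000 (suc _) = false

w00111 : Word
w00111 zero          = false
w00111 (suc zero)    = false
w00111 (suc (suc _)) = true

w11000 : Word
w11000 zero          = true
w11000 (suc zero)    = true
w11000 (suc (suc _)) = false

_≐_ : Word → Word → Set
μ ≐ ν = ∀ n → μ n ≡ ν n

Exceptional : Word → Set
Exceptional μ = μ ≐ w0111 ⊎ μ ≐ w1000 ⊎ μ ≐ w00111 ⊎ μ ≐ w11000

-- Index the vertices by position p = v + 1. Among the earlier vertices, the vertex at
-- position k + 1 is adjacent either only to its predecessor (μ_k = 1) or to all but
-- its predecessor (μ_k = 0); either way it separates its predecessor from every earlier
-- vertex. Hence a module containing two vertices contains every later vertex. Going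
-- down, if a module contains every vertex above position n but not n itself, then the
-- vertex at n separates its successor from every later vertex unless μ flips after n,
-- and every vertex below n is in the module; for n ≥ 2 the successor argument then puts
-- n in the module after all, and for n ≤ 1 this pins μ down to an exceptional word.
-- Conversely, in the exceptional graphs the vertex -1 or 0 is isolated or universal,
-- so its complement is a nontrivial module.
module Submission where

open import Defs
open import Level using (0ℓ)
open import Axiom.ExcludedMiddle using (ExcludedMiddle)
open import Relation.Nullary using (¬_; yes; no; contradiction)
open import Relation.Nullary.Decidable using (map′; decidable-stable)
open import Function.Bundles using (_⇔_; mk⇔)
open import Data.Nat using (ℕ; zero; suc; _<_; _≟_; _≤_; _≤′_; ≤′-refl; ≤′-step; z≤n; s≤s)
open import Data.Nat.Properties
  using (≤-refl; <⇒≤; <-irrefl; <-asym; <-≤-trans; <-cmp; m≤n⇒m≤1+n; m≤n⇒m<n∨m≡n;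
         ≤⇒≤′; ≤′⇒≤; suc-injective)
open import Data.Bool using (true; false; not)
open import Data.Product using (_×_; ∃-syntax; _,_; proj₁)
open import Data.Sum using (_⊎_; inj₁; inj₂; map₂)
open import Relation.Binary.PropositionalEquality using (_≡_; _≢_; refl; sym; trans; cong; subst)
open import Relation.Binary.Definitions using (DecidableEquality; tri<; tri≈; tri>)

vertex : ℕ → V
vertex zero    = minus1
vertex (suc k) = nat k

vertex-pos : ∀ v → vertex (pos v) ≡ v
vertex-pos minus1  = refl
vertex-pos (nat n) = refl

pos-vertex : ∀ p → pos (vertex p) ≡ p
pos-vertex zero    = refl
pos-vertex (suc p) = refl

pos-injective : ∀ {v w} → pos v ≡ pos w → v ≡ w
pos-injective {v} {w} eq = trans (sym (vertex-pos v)) (trans (cong vertex eq) (vertex-pos w))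

_≟ᵥ_ : DecidableEquality V
v ≟ᵥ w = map′ pos-injective (cong pos) (pos v ≟ pos w)

later-≢ : ∀ {v w} → pos v < pos w → w ≢ v
later-≢ pv<pw w≡v = <-irrefl (sym (cong pos w≡v)) pv<pw

true≢false : true ≢ false
true≢false ()

Adj-sym : ∀ {μ} x y → Adj μ x y → Adj μ y x
Adj-sym minus1  (nat j) a        = a
Adj-sym (nat i) minus1  a        = a
Adj-sym (nat i) (nat j) (inj₁ a) = inj₂ a
Adj-sym (nat i) (nat j) (inj₂ a) = inj₁ a

Adj-irrefl : ∀ {μ} v → ¬ Adj μ v v
Adj-irrefl (nat i) (inj₁ (i<i , _)) = <-irrefl refl i<i
Adj-irrefl (nat i) (inj₂ (i<i , _)) = <-irrefl refl i<i

-- The vertex nat k sits at position k + 1, so vertex k is its predecessor.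

Adj⇒EdgeUp : ∀ {μ p k} → p ≤ k → Adj μ (nat k) (vertex p) → EdgeUp μ (vertex p) k
Adj⇒EdgeUp {p = zero}  _   e                  = e
Adj⇒EdgeUp {p = suc i} i<k (inj₁ (k<i , _))  = contradiction i<k (<-asym k<i)
Adj⇒EdgeUp {p = suc i} _   (inj₂ (_ , e))    = e

EdgeUp⇒Adj : ∀ {μ p k} → p ≤ k → EdgeUp μ (vertex p) k → Adj μ (nat k) (vertex p)
EdgeUp⇒Adj {p = zero}  _   e = e
EdgeUp⇒Adj {p = suc i} i<k e = inj₂ (i<k , e)

successor-position : ∀ {p k} → suc (pos (vertex p)) ≡ suc k → p ≡ k
successor-position {p} eq = trans (sym (pos-vertex p)) (suc-injective eq)

adj-predecessor : ∀ {μ k} → μ k ≡ true → Adj μ (nat k) (vertex k)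
adj-predecessor {k = k} μk = EdgeUp⇒Adj ≤-refl (inj₁ (μk , cong suc (pos-vertex k)))

nonadj-predecessor : ∀ {μ k} → μ k ≡ false → ¬ Adj μ (nat k) (vertex k)
nonadj-predecessor {k = k} μk a with Adj⇒EdgeUp ≤-refl a
... | inj₁ (μk′ , _) = true≢false (trans (sym μk′) μk)
... | inj₂ (_ , ≢)  = ≢ (cong suc (pos-vertex k))

nonadj-earlier : ∀ {μ p k} → p < k → μ k ≡ true → ¬ Adj μ (nat k) (vertex p)
nonadj-earlier p<k μk a with Adj⇒EdgeUp (<⇒≤ p<k) a
... | inj₁ (_ , eq)   = <-irrefl (successor-position eq) p<k
... | inj₂ (μk′ , _) = true≢false (trans (sym μk) μk′)

adj-earlier : ∀ {μ p k} → p < k → μ k ≡ false → Adj μ (nat k) (vertex p)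
adj-earlier p<k μk =
  EdgeUp⇒Adj (<⇒≤ p<k) (inj₂ (μk , λ eq → <-irrefl (successor-position eq) p<k))

flipped-from-0 : ∀ {μ} → (∀ {j} → 0 < j → μ j ≡ not (μ 0)) → μ ≐ w0111 ⊎ μ ≐ w1000
flipped-from-0 {μ} flips with μ 0 in μ0
... | false = inj₁ λ { zero → μ0 ; (suc k) → flips (s≤s z≤n) }
... | true  = inj₂ λ { zero → μ0 ; (suc k) → flips (s≤s z≤n) }

flipped-from-1 : ∀ {μ} → μ 0 ≡ μ 1 → (∀ {j} → 1 < j → μ j ≡ not (μ 1)) →
                 μ ≐ w00111 ⊎ μ ≐ w11000
flipped-from-1 {μ} μ0≡μ1 flips with μ 1 in μ1
... | false = inj₁ λ { zero → μ0≡μ1 ; (suc zero) → μ1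
                     ; (suc (suc k)) → flips (s≤s (s≤s z≤n)) }
... | true  = inj₂ λ { zero → μ0≡μ1 ; (suc zero) → μ1
                     ; (suc (suc k)) → flips (s≤s (s≤s z≤n)) }

module _ (em : ExcludedMiddle 0ℓ) {μ : Word} {M : V → Set} (isModule : IsModule μ M) where

  separator-∈ : ∀ {x a b} → M a → M b → Adj μ x a → ¬ Adj μ x b → M x
  separator-∈ {x} {a} {b} Ma Mb xa ¬xb with em {M x}
  ... | yes Mx = Mx
  ... | no ¬Mx with isModule x ¬Mx
  ...   | inj₁ adjAll  = contradiction (adjAll b Mb) ¬xb
  ...   | inj₂ adjNone = contradiction xa (adjNone a Ma)

  separator-∈ʳ : ∀ {x a b} → M a → M b → Adj μ a x → ¬ Adj μ b x → M x
  separator-∈ʳ {x} {a} {b} Ma Mb ax ¬bx =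
    separator-∈ Ma Mb (Adj-sym a x ax) (λ xb → ¬bx (Adj-sym x b xb))

  successor-∈ : ∀ {a b} → a < b → M (vertex a) → M (vertex b) → M (vertex (suc b))
  successor-∈ {b = b} a<b Ma Mb with μ b in μb
  ... | true  = separator-∈ Mb Ma (adj-predecessor μb) (nonadj-earlier a<b μb)
  ... | false = separator-∈ Ma Mb (adj-earlier a<b μb) (nonadj-predecessor μb)

  ContainsFrom : ℕ → Set
  ContainsFrom n = ∀ {q} → n ≤ q → M (vertex q)

  contains-from-second : ∀ {a b} → a < b → M (vertex a) → M (vertex b) → ContainsFrom b
  contains-from-second {b = b} a<b Ma Mb b≤q = go (≤⇒≤′ b≤q)
    where
    go : ∀ {q} → b ≤′ q → M (vertex q)
    go ≤′-refl        = Mb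
    go (≤′-step b≤′q) = successor-∈ (<-≤-trans a<b (≤′⇒≤ b≤′q)) Ma (go b≤′q)

  module Gap {n : ℕ} (above : ContainsFrom (suc n)) (¬Mn : ¬ M (vertex n)) where

    flips-after : ∀ {j} → n < j → μ j ≡ not (μ n)
    flips-after {j} n<j with μ n in μn | μ j in μj
    ... | true  | false = refl
    ... | false | true  = refl
    ... | true  | true  = contradiction
      (separator-∈ʳ (above ≤-refl) (above (s≤s (<⇒≤ n<j)))
        (adj-predecessor μn) (nonadj-earlier n<j μj)) ¬Mn
    ... | false | false = contradiction
      (separator-∈ʳ (above (s≤s (<⇒≤ n<j))) (above ≤-refl)
        (adj-earlier n<j μj) (nonadj-predecessor μn)) ¬Mn

    below-∈ : ∀ {x} → x < n → M (vertex x)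
    below-∈ x<n with μ n in μn | flips-after (≤-refl {suc n})
    ... | true  | μsn = separator-∈ʳ (above (m≤n⇒m≤1+n ≤-refl)) (above ≤-refl)
                          (adj-earlier (m≤n⇒m≤1+n x<n) μsn) (nonadj-earlier x<n μn)
    ... | false | μsn = separator-∈ʳ (above ≤-refl) (above (m≤n⇒m≤1+n ≤-refl))
                          (adj-earlier x<n μn) (nonadj-earlier (m≤n⇒m≤1+n x<n) μsn)

  gap-exceptional : ∀ n → ContainsFrom (suc n) → ¬ M (vertex n) → Exceptional μ
  gap-exceptional zero above ¬M0 = map₂ inj₁ (flipped-from-0 flips-after)
    where open Gap above ¬M0
  gap-exceptional (suc zero) above ¬M1 = inj₂ (inj₂ (flipped-from-1 μ0≡μ1 flips-after))
    where
    open Gap above ¬M1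
    -- otherwise the vertex 0 separates -1 from 1
    μ0≡μ1 : μ 0 ≡ μ 1
    μ0≡μ1 with μ 0 in μ0 | μ 1 in μ1
    ... | false | false = refl
    ... | true  | true  = refl
    ... | true  | false = contradiction
      (separator-∈ʳ (below-∈ ≤-refl) (above ≤-refl)
        (adj-predecessor {μ} {0} μ0) (nonadj-predecessor {μ} {1} μ1)) ¬M1
    ... | false | true  = contradiction
      (separator-∈ʳ (above ≤-refl) (below-∈ ≤-refl)
        (adj-predecessor {μ} {1} μ1) (nonadj-predecessor {μ} {0} μ0)) ¬M1
  gap-exceptional (suc (suc m)) above ¬M =
    contradiction (successor-∈ ≤-refl (below-∈ (m≤n⇒m≤1+n ≤-refl)) (below-∈ ≤-refl)) ¬M
    where open Gap above ¬M

  contains-from-pred : ¬ Exceptional μ → ∀ {n} → ContainsFrom (suc n) → ContainsFrom n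
  contains-from-pred ¬exc {n} above n≤q with m≤n⇒m<n∨m≡n n≤q
  ... | inj₁ n<q  = above n<q
  ... | inj₂ refl with em {M (vertex n)}
  ...   | yes Mn  = Mn
  ...   | no ¬Mn  = contradiction (gap-exceptional n above ¬Mn) ¬exc

  contains-from-zero : ¬ Exceptional μ → ∀ n → ContainsFrom n → ContainsFrom 0
  contains-from-zero ¬exc zero    above = above
  contains-from-zero ¬exc (suc n) above = contains-from-zero ¬exc n (contains-from-pred ¬exc above)

  whole-from : ¬ Exceptional μ → ∀ {a b} → pos a < pos b → M a → M b → ∀ v → M v
  whole-from ¬exc a<b Ma Mb v = subst M (vertex-pos v)
    (contains-from-zero ¬exc _ (contains-from-second a<b (at-pos Ma) (at-pos Mb)) z≤n)
    where
    at-pos : ∀ {w} → M w → M (vertex (pos w))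
    at-pos {w} = subst M (sym (vertex-pos w))

  two-vertices-whole : ¬ Exceptional μ → ∀ {a b} → M a → M b → a ≢ b → ∀ v → M v
  two-vertices-whole ¬exc {a} {b} Ma Mb a≢b with <-cmp (pos a) (pos b)
  ... | tri< a<b _ _ = whole-from ¬exc a<b Ma Mb
  ... | tri≈ _ eq _  = contradiction (pos-injective eq) a≢b
  ... | tri> _ _ b<a = whole-from ¬exc b<a Mb Ma

pair-spanning⇒trivial : {M : V → Set} → ExcludedMiddle 0ℓ →
                        (∀ {a b} → M a → M b → a ≢ b → ∀ v → M v) → IsTrivial M
pair-spanning⇒trivial {M} em spans with em {∃[ a ] M a}
... | no ∄a = inj₁ (λ v Mv → ∄a (v , Mv))
... | yes (a , Ma) with em {∃[ b ] (M b × b ≢ a)}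
...   | yes (b , Mb , b≢a) = inj₂ (inj₂ (spans Mb Ma b≢a))
...   | no ∄b = inj₂ (inj₁ (a , λ w → only-a w , λ { refl → Ma }))
  where
  only-a : ∀ w → M w → w ≡ a
  only-a w Mw = decidable-stable (w ≟ᵥ a) (λ w≢a → ∄b (w , Mw , w≢a))

Isolated : Word → V → Set
Isolated μ v = ∀ w → ¬ Adj μ v w

Universal : Word → V → Set
Universal μ v = ∀ w → w ≢ v → Adj μ v w

isolated-or-universal⇒module : ∀ {μ v} → Isolated μ v ⊎ Universal μ v → IsModule μ (_≢ v)
isolated-or-universal⇒module {v = v} iso-or-uni x x∉ with decidable-stable (x ≟ᵥ v) x∉
isolated-or-universal⇒module (inj₁ iso) x x∉ | refl = inj₂ (λ w _ → iso w)
isolated-or-universal⇒module (inj₂ uni) x x∉ | refl = inj₁ uni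

complement-nontrivial : ∀ v → ¬ IsTrivial (_≢ v)
complement-nontrivial v (inj₁ empty)         = empty (nat (pos v)) (later-≢ ≤-refl)
complement-nontrivial v (inj₂ (inj₁ (c , singleton))) =
  later-≢ {nat (pos v)} {nat (suc (pos v))} ≤-refl
    (trans (proj₁ (singleton _) (later-≢ (m≤n⇒m≤1+n ≤-refl)))
           (sym (proj₁ (singleton _) (later-≢ ≤-refl))))
complement-nontrivial v (inj₂ (inj₂ whole))  = whole v refl

exceptional-isolated-or-universal : ∀ {μ} → Exceptional μ → ∃[ v ] (Isolated μ v ⊎ Universal μ v)
exceptional-isolated-or-universal {μ} (inj₁ e) = minus1 , inj₁ λ
  { minus1        → Adj-irrefl {μ} minus1
  ; (nat zero)    → nonadj-predecessor {μ} {0} (e 0)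
  ; (nat (suc k)) → nonadj-earlier {μ} {0} (s≤s z≤n) (e (suc k)) }
exceptional-isolated-or-universal {μ} (inj₂ (inj₁ e)) = minus1 , inj₂ λ
  { minus1        ne → contradiction refl ne
  ; (nat zero)    _  → adj-predecessor {μ} {0} (e 0)
  ; (nat (suc k)) _  → adj-earlier {μ} {0} (s≤s z≤n) (e (suc k)) }
exceptional-isolated-or-universal {μ} (inj₂ (inj₂ (inj₁ e))) = nat 0 , inj₁ λ
  { minus1              → nonadj-predecessor {μ} {0} (e 0)
  ; (nat zero)          → Adj-irrefl {μ} (nat 0)
  ; (nat (suc zero))    a → nonadj-predecessor {μ} {1} (e 1) (Adj-sym {μ} (nat 0) (nat 1) a)
  ; (nat (suc (suc k))) a → nonadj-earlier {μ} {1} (s≤s (s≤s z≤n)) (e (suc (suc k)))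
                              (Adj-sym {μ} (nat 0) (nat (suc (suc k))) a) }
exceptional-isolated-or-universal {μ} (inj₂ (inj₂ (inj₂ e))) = nat 0 , inj₂ λ
  { minus1              _  → adj-predecessor {μ} {0} (e 0)
  ; (nat zero)          ne → contradiction refl ne
  ; (nat (suc zero))    _  → Adj-sym {μ} (nat 1) (nat 0) (adj-predecessor {μ} {1} (e 1))
  ; (nat (suc (suc k))) _  → Adj-sym {μ} (nat (suc (suc k))) (nat 0)
                               (adj-earlier {μ} {1} (s≤s (s≤s z≤n)) (e (suc (suc k)))) }

exceptional-not-prime : ∀ {μ} → Exceptional μ → ¬ IsPrime μ
exceptional-not-prime exc prime with exceptional-isolated-or-universal exc
... | v , iso-or-uni = complement-nontrivial v (prime _ (isolated-or-universal⇒module iso-or-uni))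

mainTheorem18 : ExcludedMiddle 0ℓ → (μ : Word) → IsPrime μ ⇔ (¬ Exceptional μ)
mainTheorem18 em μ = mk⇔
  (λ prime exc → exceptional-not-prime exc prime)
  (λ ¬exc M isModule → pair-spanning⇒trivial em (two-vertices-whole em isModule ¬exc))
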